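{- In each of the two deduction systems DBL and DBL$_\ast$, for all formulas $\phi,\psi\in\mathcal{L}$ the sequent $\phi\vdash\psi\times\phi$ is derivable. In particular $(\psi|\top)\equiv\psi$ for every $\psi\in\mathcal{L}$.
   Context: Fix a finite set $\Theta$ of atomic propositions and a distinguished $\theta_1\in\Theta$. The language $\mathcal{L}$ is the smallest set containing $\Theta$ such that $\neg\phi$, $\phi\rightarrow\psi$ and $(\psi|\phi)$ belong to $\mathcal{L}$ whenever $\phi,\psi\in\mathcal{L}$. Abbreviations: $\phi\vee\psi:=\neg\phi\rightarrow\psi$, $\phi\wedge\psi:=\neg(\neg\phi\vee\neg\psi)$, $\phi\leftrightarrow\psi:=(\phi\rightarrow\psi)\wedge(\psi\rightarrow\phi)$, $\psi\times\phi:=(\psi|\phi)\leftrightarrow\psi$, $\top:=\theta_1\rightarrow\theta_1$, $\bot:=\neg\top$. A sequent is a pair of finite (possibly empty) sequences $\Gamma,\Delta$ of formulas of $\mathcal{L}$, written $\Gamma\vdash\Delta$; "$\Gamma,\Delta$" denotes concatenation and $\{\Gamma\}$ the set of entries of $\Gamma$. The systems DBL and DBL$_\ast$ are the smallest sets of sequents $X$ satisfying, for all $\phi,\psi,\eta\in\mathcal{L}$ and finite sequences $\Gamma,\Delta,\Lambda,\Sigma$: (CUT) if $\Gamma\vdash\Delta,\phi$ and $\Lambda,\phi\vdash\Sigma$ are in $X$ then $\Gamma,\Lambda\vdash\Delta,\Sigma$ is in $X$; (STRUCT) if $\{\Gamma\}\subset\{\Lambda\}\cup\{\top\}$, $\{\Delta\}\subset\{\Sigma\}\cup\{\bot\}$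 and $\Gamma\vdash\Delta$ is in $X$ then $\Lambda\vdash\Sigma$ is in $X$; (modus ponens) $\phi,\phi\rightarrow\psi\vdash\psi$; (c1) $\vdash\phi\rightarrow(\psi\rightarrow\phi)$; (c2) $\vdash(\eta\rightarrow(\phi\rightarrow\psi))\rightarrow((\eta\rightarrow\phi)\rightarrow(\eta\rightarrow\psi))$; (c3) $\vdash(\neg\phi\rightarrow\neg\psi)\rightarrow((\neg\phi\rightarrow\psi)\rightarrow\phi)$; (b1) $\phi\rightarrow\psi\vdash\neg\phi,(\psi|\phi)$; (b2) $\vdash(\psi\rightarrow\eta|\phi)\rightarrow((\psi|\phi)\rightarrow(\eta|\phi))$; (b3) $\vdash(\psi|\phi)\rightarrow(\phi\rightarrow\psi)$; (b4) $\vdash\neg(\neg\psi|\phi)\leftrightarrow(\psi|\phi)$. DBL additionally contains (b5) $\psi\times\phi\vdash\phi\times\psi$. DBL$_\ast$ instead additionally contains (b5.weak.A) $\psi\times\neg\phi\vdash\psi\times\phi$ and $\psi\times\phi\vdash\psi\times\neg\phi$, and (b5.weak.B) $\psi\leftrightarrow\eta\vdash(\phi|\psi)\leftrightarrow(\phi|\eta)$. A sequent is derivable if it belongs to the system; $\phi\equiv\psi$ means that $\vdash\phi\leftrightarrow\psi$ is derivable. -}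

module Defs where

open import Data.Nat using (ℕ; suc)
open import Data.Fin using (Fin; zero)
open import Data.List using (List; []; _∷_; _++_; [_])
open import Data.List.Membership.Propositional using (_∈_)
open import Data.Sum using (_⊎_)
open import Relation.Binary.PropositionalEquality using (_≡_)
open import Data.Product using (_×_)

-- Θ is a finite set of atoms; we take Θ = Fin (suc n), with θ₁ = zero.
data Form (n : ℕ) : Set where
  atom : Fin (suc n) → Form n
  ¬'_  : Form n → Form n
  _⇒_  : Form n → Form n → Form n
  _∣_  : Form n → Form n → Form n

infixr 5 _⇒_
infix 7 ¬'_

module _ {n : ℕ} where
  θ₁ : Form n
  θ₁ = atom zero

  _∨'_ : Form n → Form n → Form n
  φ ∨' ψ = (¬' φ) ⇒ ψ

  _∧'_ : Form n → Form n → Form n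
  φ ∧' ψ = ¬' ((¬' φ) ∨' (¬' ψ))

  _⇔_ : Form n → Form n → Form n
  φ ⇔ ψ = (φ ⇒ ψ) ∧' (ψ ⇒ φ)

  -- ψ × φ := (ψ|φ) ↔ ψ
  _⊠_ : Form n → Form n → Form n
  ψ ⊠ φ = (ψ ∣ φ) ⇔ ψ

  ⊤' : Form n
  ⊤' = θ₁ ⇒ θ₁

  ⊥' : Form n
  ⊥' = ¬' ⊤'

data System : Set where
  DBL DBL* : System

_⊆∪_ : {n : ℕ} → List (Form n) → List (Form n) × Form n → Set
_⊆∪_ {n} Γ (Λ Data.Product., e) = ∀ (x : Form n) → x ∈ Γ → (x ∈ Λ ⊎ x ≡ e)

data Derivable {n : ℕ} (S : System) : List (Form n) → List (Form n) → Set where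
  cut : ∀ {Γ Δ Λ Σ φ} → Derivable S Γ (Δ ++ [ φ ]) → Derivable S (Λ ++ [ φ ]) Σ
      → Derivable S (Γ ++ Λ) (Δ ++ Σ)
  struct : ∀ {Γ Δ Λ Σ} → Γ ⊆∪ (Λ Data.Product., ⊤') → Δ ⊆∪ (Σ Data.Product., ⊥')
      → Derivable S Γ Δ → Derivable S Λ Σ
  mp : ∀ φ ψ → Derivable S (φ ∷ (φ ⇒ ψ) ∷ []) [ ψ ]
  c1 : ∀ φ ψ → Derivable S [] [ φ ⇒ (ψ ⇒ φ) ]
  c2 : ∀ η φ ψ → Derivable S [] [ (η ⇒ (φ ⇒ ψ)) ⇒ ((η ⇒ φ) ⇒ (η ⇒ ψ)) ]
  c3 : ∀ φ ψ → Derivable S [] [ ((¬' φ) ⇒ (¬' ψ)) ⇒ (((¬' φ) ⇒ ψ) ⇒ φ) ]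
  b1 : ∀ φ ψ → Derivable S [ φ ⇒ ψ ] ((¬' φ) ∷ (ψ ∣ φ) ∷ [])
  b2 : ∀ φ ψ η → Derivable S [] [ ((ψ ⇒ η) ∣ φ) ⇒ ((ψ ∣ φ) ⇒ (η ∣ φ)) ]
  b3 : ∀ φ ψ → Derivable S [] [ (ψ ∣ φ) ⇒ (φ ⇒ ψ) ]
  b4 : ∀ φ ψ → Derivable S [] [ (¬' ((¬' ψ) ∣ φ)) ⇔ (ψ ∣ φ) ]
  b5 : S ≡ DBL → ∀ φ ψ → Derivable S [ ψ ⊠ φ ] [ φ ⊠ ψ ]
  b5wA₁ : S ≡ DBL* → ∀ φ ψ → Derivable S [ ψ ⊠ (¬' φ) ] [ ψ ⊠ φ ]
  b5wA₂ : S ≡ DBL* → ∀ φ ψ → Derivable S [ ψ ⊠ φ ] [ ψ ⊠ (¬' φ) ]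
  b5wB  : S ≡ DBL* → ∀ φ ψ η → Derivable S [ ψ ⇔ η ] [ (φ ∣ ψ) ⇔ (φ ∣ η) ]

Equiv : {n : ℕ} → System → Form n → Form n → Set
Equiv S φ ψ = Derivable S [] [ φ ⇔ ψ ]

{-# OPTIONS --safe #-}
-- Given φ, axiom b3 yields (ψ|φ) → ψ, and b3 for ¬ψ yields (¬ψ|φ) → ¬ψ,
-- i.e. ψ → ¬(¬ψ|φ), which b4 turns into ψ → (ψ|φ). For φ = ⊤ the hypothesis
-- can be discarded by STRUCT, giving (ψ|⊤) ≡ ψ.
module Submission where

open import Defs
open import Data.Nat using (ℕ)
open import Data.List using (List; []; [_]; _∷_)
open import Data.List.Membership.Propositional using (_∈_)
open import Data.List.Relation.Unary.Any using (here; there)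
open import Data.Product using (_×_; _,_)
open import Data.Sum using (inj₁; inj₂)
open import Relation.Binary.PropositionalEquality using (refl)

module HilbertCalculus {n : ℕ} (S : System) where

  infix  3 _⊢_
  infixl 5 _·_

  data _⊢_ (Γ : List (Form n)) : Form n → Set where
    hyp : ∀ {A} → A ∈ Γ → Γ ⊢ A
    thm : ∀ {A} → Derivable S [] [ A ] → Γ ⊢ A
    _·_ : ∀ {A B} → Γ ⊢ A ⇒ B → Γ ⊢ A → Γ ⊢ B

  h₀ : ∀ {Γ A} → A ∷ Γ ⊢ A
  h₀ = hyp (here refl)

  h₁ : ∀ {Γ A B} → B ∷ A ∷ Γ ⊢ A
  h₁ = hyp (there (here refl))

  h₂ : ∀ {Γ A B C} → C ∷ B ∷ A ∷ Γ ⊢ A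
  h₂ = hyp (there (there (here refl)))

  weaken : ∀ {Γ A B} → Γ ⊢ A → B ∷ Γ ⊢ A
  weaken (hyp p) = hyp (there p)
  weaken (thm d) = thm d
  weaken (f · x) = weaken f · weaken x

  ⇒-refl : ∀ {Γ} A → Γ ⊢ A ⇒ A
  ⇒-refl A = thm (c2 A (A ⇒ A) A) · thm (c1 A (A ⇒ A)) · thm (c1 A A)

  deduction : ∀ {Γ A B} → A ∷ Γ ⊢ B → Γ ⊢ A ⇒ B
  deduction {A = A} (hyp (here refl)) = ⇒-refl A
  deduction {A = A} (hyp (there p))   = thm (c1 _ A) · hyp p
  deduction {A = A} (thm d)           = thm (c1 _ A) · thm d
  deduction {A = A} (f · x)           = thm (c2 A _ _) · deduction f · deduction x

  derivable-mp : ∀ {A B : Form n} → Derivable S [] [ A ] → Derivable S [] [ A ⇒ B ]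
               → Derivable S [] [ B ]
  derivable-mp {A} {B} a f =
    cut {Γ = []} {Δ = []} {Λ = []} a (cut {Γ = []} {Δ = []} {Λ = [ A ]} f (mp A B))

  closed⇒derivable : ∀ {A : Form n} → [] ⊢ A → Derivable S [] [ A ]
  closed⇒derivable (thm d) = d
  closed⇒derivable (f · x) = derivable-mp (closed⇒derivable x) (closed⇒derivable f)

  hypothetical⇒derivable : ∀ {A B : Form n} → [ A ] ⊢ B → Derivable S [ A ] [ B ]
  hypothetical⇒derivable {A} p =
    cut {Γ = []} {Δ = []} {Λ = [ A ]} (closed⇒derivable (deduction p)) (mp A _)

  ¬¬-elim : ∀ {Γ} A → Γ ⊢ ¬' ¬' A ⇒ A
  ¬¬-elim A = deduction (thm (c3 A (¬' A)) · (thm (c1 _ _) · h₀) · ⇒-refl _)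

  ¬¬-intro : ∀ {Γ} A → Γ ⊢ A ⇒ ¬' ¬' A
  ¬¬-intro A = deduction (thm (c3 (¬' ¬' A) A) · ¬¬-elim _ · (thm (c1 _ _) · h₀))

  ex-falso : ∀ {Γ} A B → Γ ⊢ ¬' A ⇒ A ⇒ B
  ex-falso A B =
    deduction (deduction (thm (c3 B A) · (thm (c1 _ _) · h₁) · (thm (c1 _ _) · h₀)))

  contraposition : ∀ {Γ A B} → Γ ⊢ A ⇒ ¬' B → Γ ⊢ B ⇒ ¬' A
  contraposition {A = A} {B} p =
    deduction (thm (c3 (¬' A) B) · deduction (weaken (weaken p) · (¬¬-elim A · h₀))
                                 · (thm (c1 _ _) · h₀))

  ∧-intro : ∀ {Γ A B} → Γ ⊢ A → Γ ⊢ B → Γ ⊢ A ∧' B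
  ∧-intro {A = A} {B} a b =
    contraposition (deduction (h₀ · (¬¬-intro A · weaken a))) · b

  ∧-elimˡ : ∀ {Γ A B} → Γ ⊢ A ∧' B → Γ ⊢ A
  ∧-elimˡ {A = A} {B} p =
    thm (c3 A (¬' ¬' A ⇒ ¬' B)) · (thm (c1 _ _) · p)
      · deduction (deduction (ex-falso A (¬' B) · h₁ · (¬¬-elim A · h₀)))

  conditional-absorbs-hypothesis : (φ ψ : Form n) → [ φ ] ⊢ ψ ⊠ φ
  conditional-absorbs-hypothesis φ ψ = ∧-intro conditional⇒ψ ψ⇒conditional
    where
    conditional⇒ψ : [ φ ] ⊢ (ψ ∣ φ) ⇒ ψ
    conditional⇒ψ = deduction (thm (b3 φ ψ) · h₀ · h₁)

    ψ⇒conditional : [ φ ] ⊢ ψ ⇒ (ψ ∣ φ)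
    ψ⇒conditional = deduction
      (∧-elimˡ (thm (b4 φ ψ))
        · (contraposition (deduction (thm (b3 φ (¬' ψ)) · h₀ · h₂)) · h₀))

  ⊠-of-hypothesis : (φ ψ : Form n) → Derivable S [ φ ] [ ψ ⊠ φ ]
  ⊠-of-hypothesis φ ψ = hypothetical⇒derivable (conditional-absorbs-hypothesis φ ψ)

discharge-⊤ : ∀ {n S} {Δ : List (Form n)} → Derivable S [ ⊤' ] Δ → Derivable S [] Δ
discharge-⊤ = struct ⊤-only (λ x p → inj₁ p)
  where
  ⊤-only : ∀ {n} → [ ⊤' ] ⊆∪ ([] , ⊤' {n})
  ⊤-only x (here e) = inj₂ e

mainTheorem1 : (n : ℕ) → (S : System)
    → ((φ ψ : Form n) → Derivable S [ φ ] [ ψ ⊠ φ ])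
    × ((ψ : Form n) → Equiv S (ψ ∣ ⊤') ψ)
mainTheorem1 n S = ⊠-of-hypothesis , λ ψ → discharge-⊤ (⊠-of-hypothesis ⊤' ψ)
  where open HilbertCalculus {n} S
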